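{- For every $n$, no orientation of the path $P_n$ induced by a $p_2$-configuration contains two adjacent flat edges.
   Context: Parallel Diffusion on a finite simple graph $G$: a configuration assigns an integer stack size $|v|$ (possibly negative) to each vertex. In one step all vertices fire simultaneously: each vertex sends one chip to each neighbour with strictly smaller stack size. Starting from $C_0$, $C_{t+1}$ is obtained from $C_t$ by one step. A configuration $D$ is a $p_2$-configuration if there are $C_0$ and $N$ such that $C_{t+2}=C_t$ and $C_{t+1}\ne C_t$ for all $t\ge N$, and $D=C_t$ for some $t\ge N$. The path $P_n$ has vertices $v_1,\dots,v_n$ and edges $e_i=v_iv_{i+1}$; edges $e_i,e_{i+1}$ are adjacent. A configuration induces the orientation in which each edge is directed from its endpoint with larger stack size to its endpoint with smaller stack size, and is flat (undirected) if the stack sizes are equal. -}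

module Defs where

open import Data.Nat using (ℕ; zero; suc)
open import Data.Fin using (Fin; toℕ)
open import Data.Integer using (ℤ; _+_; _-_; _<_; _<?_; 0ℤ; 1ℤ)
open import Data.List using (List; foldr; map)
open import Data.Fin.Base using () 
open import Data.List using (allFin)
open import Data.Product using (Σ; _×_; ∃; ∃-syntax)
open import Data.Sum using (_⊎_)
open import Relation.Nullary using (Dec; yes; no; ¬_)
open import Relation.Nullary.Decidable using (_×-dec_)
open import Relation.Binary.PropositionalEquality using (_≡_)
open import Data.Nat.Properties using () renaming (_≟_ to _≟ℕ_)
open import Data.Sum using (inj₁; inj₂)
open import Level using (0ℓ)

record SimpleGraph (n : ℕ) : Set₁ where
  field
    Adj      : Fin n → Fin n → Set
    adj?     : (u v : Fin n) → Dec (Adj u v)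
    symmetric   : ∀ {u v} → Adj u v → Adj v u
    irreflexive : ∀ {v} → ¬ Adj v v

Config : ℕ → Set
Config n = Fin n → ℤ

Σᵥ : ∀ {n} → (Fin n → ℤ) → ℤ
Σᵥ {n} f = foldr _+_ 0ℤ (map f (allFin n))

[_] : ∀ {P : Set} → Dec P → ℤ
[ yes _ ] = 1ℤ
[ no  _ ] = 0ℤ

-- One step of Parallel Diffusion: every vertex simultaneously sends one chip
-- to each neighbour with strictly smaller stack size (and so receives one chip
-- from each neighbour with strictly larger stack size).
step : ∀ {n} → SimpleGraph n → Config n → Config n
step G C v =
  C v + Σᵥ (λ u → [ adj? u v ×-dec (C v <? C u) ])
      - Σᵥ (λ u → [ adj? v u ×-dec (C u <? C v) ])
  where open SimpleGraph G

run : ∀ {n} → SimpleGraph n → Config n → ℕ → Config n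
run G C zero    = C
run G C (suc t) = step G (run G C t)

_≈_ : ∀ {n} → Config n → Config n → Set
C ≈ D = ∀ v → C v ≡ D v

IsP2Config : ∀ {n} → SimpleGraph n → Config n → Set
IsP2Config G D =
  Σ (Config _) λ C₀ → Σ ℕ λ N →
    (∀ t → N Data.Nat.≤ t →
       (run G C₀ (suc (suc t)) ≈ run G C₀ t) × ¬ (run G C₀ (suc t) ≈ run G C₀ t))
    × (Σ ℕ λ t → N Data.Nat.≤ t × (D ≈ run G C₀ t))

-- The path P_n : vertices v_1..v_n (here indices 0..n-1), v_i ~ v_{i+1}.
PathAdj : ∀ {n} → Fin n → Fin n → Set
PathAdj u v = (suc (toℕ u) ≡ toℕ v) ⊎ (suc (toℕ v) ≡ toℕ u)

pathAdj? : ∀ {n} (u v : Fin n) → Dec (PathAdj u v)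
pathAdj? u v with suc (toℕ u) ≟ℕ toℕ v | suc (toℕ v) ≟ℕ toℕ u
... | yes p | _     = yes (inj₁ p)
... | no _  | yes q = yes (inj₂ q)
... | no p  | no q  = no λ { (inj₁ x) → p x ; (inj₂ y) → q y }

private
  sym⊎ : ∀ {n} {u v : Fin n} → PathAdj u v → PathAdj v u
  sym⊎ (inj₁ p) = inj₂ p
  sym⊎ (inj₂ q) = inj₁ q

  noloop : ∀ (m : ℕ) → ¬ (suc m ≡ m)
  noloop zero ()
  noloop (suc m) p = noloop m (Data.Nat.Properties.suc-injective p)

  irr : ∀ {n} {v : Fin n} → ¬ PathAdj v v
  irr {v = v} (inj₁ p) = noloop (toℕ v) p
  irr {v = v} (inj₂ p) = noloop (toℕ v) p

Path : (n : ℕ) → SimpleGraph n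
Path n = record
  { Adj = PathAdj ; adj? = pathAdj? ; symmetric = sym⊎ ; irreflexive = irr }

-- Two adjacent flat edges e_i = v_i v_{i+1}, e_{i+1} = v_{i+1} v_{i+2} in the
-- orientation induced by D: both edges have equal stack sizes at their ends.
HasTwoAdjacentFlatEdges : ∀ {n} → Config n → Set
HasTwoAdjacentFlatEdges {n} D =
  Σ (Fin n) λ a → Σ (Fin n) λ b → Σ (Fin n) λ c →
    (suc (toℕ a) ≡ toℕ b) × (suc (toℕ b) ≡ toℕ c) × (D a ≡ D b) × (D b ≡ D c)

module Submission where

-- On the path, a step changes the stack of a vertex by the difference of the chip flows
-- through its two incident edges.  If C has period 2, adding the two balance equations at
-- each vertex shows that flow C i + flow (step C) i does not depend on i; it vanishes at the ends of the path, so every edge reverses its flow each step.  In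
-- particular a flat edge stays flat in step C, and comparing the new stacks at its two ends
-- shows that the edges on either side of it carry opposite flows.  Hence two adjacent flat
-- edges make the whole path flat, so step C = C, contradicting period exactly 2.

open import Defs
open import Algebra.Properties.CommutativeMonoid.Sum as Sum using ()
open import Data.Nat as ℕ using (ℕ; zero; suc; _≟_; _≤′_; ≤′-refl; ≤′-step)
open import Data.Nat.Properties as ℕP using ()
open import Data.Fin using (Fin; zero; suc; toℕ; fromℕ<; inject₁; punchIn)
open import Data.Fin.Properties using (toℕ-injective; toℕ<n; toℕ-fromℕ<; toℕ-inject₁; punchInᵢ≢i)
open import Data.Integer using (ℤ; _+_; _-_; -_; _<?_; 0ℤ)
open import Data.Integer.Properties as ℤP using ()
open import Data.Integer.Tactic.RingSolver using (solve-∀)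
open import Data.List using (foldr; tabulate)
open import Data.List.Properties using (map-tabulate)
open import Data.Product using (_×_; _,_; proj₁; proj₂)
open import Data.Sum using ([_,_]′)
open import Function using (_∘_; id)
open import Relation.Nullary using (Dec; yes; no; ¬_; contradiction)
open import Relation.Nullary.Decidable using (_×-dec_; dec-yes; dec-no)
open import Relation.Binary using (tri<; tri≈; tri>)
open import Relation.Binary.PropositionalEquality
  using (_≡_; _≢_; refl; sym; trans; cong; cong₂; subst; module ≡-Reasoning)

open Sum ℤP.+-0-commutativeMonoid using (sum; sum-remove; sum-cong-≗; sum-replicate-zero; ∑-distrib-+)

Σᵥ≡sum : ∀ {n} (f : Fin n → ℤ) → Σᵥ f ≡ sum f
Σᵥ≡sum {n} f = trans (cong (foldr _+_ 0ℤ) (map-tabulate id f)) (foldr-tabulate n f)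
  where
  foldr-tabulate : ∀ n (f : Fin n → ℤ) → foldr _+_ 0ℤ (tabulate f) ≡ sum f
  foldr-tabulate zero    f = refl
  foldr-tabulate (suc n) f = cong (f zero +_) (foldr-tabulate n (f ∘ suc))

Σᵥ-distrib-+ : ∀ {n} (f g : Fin n → ℤ) → Σᵥ (λ u → f u + g u) ≡ Σᵥ f + Σᵥ g
Σᵥ-distrib-+ f g = trans (Σᵥ≡sum (λ u → f u + g u))
  (trans (∑-distrib-+ f g) (sym (cong₂ _+_ (Σᵥ≡sum f) (Σᵥ≡sum g))))

Σᵥ-cong : ∀ {n} {f g : Fin n → ℤ} → (∀ u → f u ≡ g u) → Σᵥ f ≡ Σᵥ g
Σᵥ-cong {f = f} {g} f≗g = trans (Σᵥ≡sum f) (trans (sum-cong-≗ f≗g) (sym (Σᵥ≡sum g)))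

Σᵥ-zero : ∀ {n} (f : Fin n → ℤ) → (∀ u → f u ≡ 0ℤ) → Σᵥ f ≡ 0ℤ
Σᵥ-zero {n} f f≗0 = trans (Σᵥ≡sum f) (trans (sum-cong-≗ f≗0) (sum-replicate-zero n))

Σᵥ-single : ∀ {n} (f : Fin n → ℤ) (w : Fin n) → (∀ u → u ≢ w → f u ≡ 0ℤ) → Σᵥ f ≡ f w
Σᵥ-single {suc n} f w vanish = begin
  Σᵥ f                         ≡⟨ Σᵥ≡sum f ⟩
  sum f                        ≡⟨ sum-remove {i = w} f ⟩
  f w + sum (f ∘ punchIn w)    ≡⟨ cong (f w +_) (trans (sum-cong-≗ rest) (sum-replicate-zero n)) ⟩
  f w + 0ℤ                     ≡⟨ ℤP.+-identityʳ (f w) ⟩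
  f w                          ∎
  where
  open ≡-Reasoning
  rest : ∀ j → f (punchIn w j) ≡ 0ℤ
  rest j = vanish (punchIn w j) (punchInᵢ≢i w j)

[×]-no : ∀ {A B : Set} (a? : Dec A) (b? : Dec B) → ¬ A → [ a? ×-dec b? ] ≡ 0ℤ
[×]-no (yes a) _ ¬a = contradiction a ¬a
[×]-no (no _)  _ _  = refl

[×]-yes : ∀ {A B : Set} (a? : Dec A) (b? : Dec B) → A → [ a? ×-dec b? ] ≡ [ b? ]
[×]-yes (yes _) (yes _) _ = refl
[×]-yes (yes _) (no _)  _ = refl
[×]-yes (no ¬a) _       a = contradiction a ¬a

module _ {n} {R Q : Fin n → Set} (R? : ∀ u → Dec (R u)) (Q? : ∀ u → Dec (Q u)) where

  Σᵥ-[×]-none : (∀ u → ¬ R u) → Σᵥ (λ u → [ R? u ×-dec Q? u ]) ≡ 0ℤ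
  Σᵥ-[×]-none ¬R = Σᵥ-zero _ (λ u → [×]-no (R? u) (Q? u) (¬R u))

  Σᵥ-[×]-unique : ∀ {w} → R w → (∀ {u} → R u → u ≡ w) →
                  Σᵥ (λ u → [ R? u ×-dec Q? u ]) ≡ [ Q? w ]
  Σᵥ-[×]-unique {w} Rw R-unique =
    trans (Σᵥ-single _ w (λ u u≢w → [×]-no (R? u) (Q? u) (u≢w ∘ R-unique)))
          ([×]-yes (R? w) (Q? w) Rw)

gain : ℤ → ℤ → ℤ
gain x y = [ x <? y ] - [ y <? x ]

gain-refl : ∀ x → gain x x ≡ 0ℤ
gain-refl x = ℤP.+-inverseʳ [ x <? x ]

gain-antisym : ∀ x y → gain x y ≡ - gain y x
gain-antisym x y = negate-difference [ x <? y ] [ y <? x ]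
  where
  negate-difference : ∀ a b → a - b ≡ - (b - a)
  negate-difference = solve-∀

gain≡0⇒≡ : ∀ x y → gain x y ≡ 0ℤ → x ≡ y
gain≡0⇒≡ x y with ℤP.<-cmp x y
... | tri≈ _ x≡y _ = λ _ → x≡y
... | tri< x<y _ y≮x rewrite proj₂ (dec-yes (x <? y) x<y) | dec-no (y <? x) y≮x = λ ()
... | tri> x≮y _ y<x rewrite dec-no (x <? y) x≮y | proj₂ (dec-yes (y <? x) y<x) = λ ()

-- flow C i is the net number of chips vertex i sends to vertex i − 1 in one step;
-- it is 0 when there is no such edge, i.e. for i = 0 and i ≥ n.
flow : ∀ {n} → Config n → ℕ → ℤ
flow               C zero          = 0ℤ
flow {suc (suc n)} C (suc zero)    = gain (C zero) (C (suc zero))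
flow {suc n}       C (suc (suc i)) = flow (C ∘ suc) (suc i)
flow               C (suc _)       = 0ℤ

flow-edge : ∀ {n} (C : Config n) {u w : Fin n} → suc (toℕ u) ≡ toℕ w →
            flow C (toℕ w) ≡ gain (C u) (C w)
flow-edge C {zero}  {suc zero}    refl = refl
flow-edge C {suc u} {suc (suc w)} eq   = flow-edge (C ∘ suc) (ℕP.suc-injective eq)
flow-edge C {zero}  {zero}        ()
flow-edge C {zero}  {suc (suc w)} ()
flow-edge C {suc u} {zero}        ()
flow-edge C {suc u} {suc zero}    ()

flow-beyond : ∀ {n} (C : Config n) {i} → n ℕ.≤ i → flow C i ≡ 0ℤ
flow-beyond {zero}        C {zero}        _         = refl
flow-beyond {zero}        C {suc i}       _         = refl
flow-beyond {suc zero}    C {suc zero}    _         = refl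
flow-beyond {suc zero}    C {suc (suc i)} _         = refl
flow-beyond {suc (suc n)} C {suc (suc i)} (ℕ.s≤s le) = flow-beyond (C ∘ suc) le

flat-edge⇒≡ : ∀ {n} (C : Config n) {u w : Fin n} → suc (toℕ u) ≡ toℕ w →
              flow C (toℕ w) ≡ 0ℤ → C u ≡ C w
flat-edge⇒≡ C u→w flat = gain≡0⇒≡ _ _ (trans (sym (flow-edge C u→w)) flat)

≡⇒flat-edge : ∀ {n} (C : Config n) {u w : Fin n} → suc (toℕ u) ≡ toℕ w →
              C u ≡ C w → flow C (toℕ w) ≡ 0ℤ
≡⇒flat-edge C {u} {w} u→w Cu≡Cw =
  trans (flow-edge C u→w) (trans (cong (λ x → gain x (C w)) Cu≡Cw) (gain-refl (C w)))

[pathAdj×]-split : ∀ {n} {P : Set} (u v : Fin n) (p? : Dec P) →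
  [ pathAdj? u v ×-dec p? ] ≡ [ (suc (toℕ u) ≟ toℕ v) ×-dec p? ] + [ (suc (toℕ v) ≟ toℕ u) ×-dec p? ]
[pathAdj×]-split u v p? with suc (toℕ u) ≟ toℕ v | suc (toℕ v) ≟ toℕ u | p?
... | yes u→v | yes v→u | _     = contradiction (sym (trans (cong suc u→v) v→u)) (ℕP.m≢1+n+m (toℕ u) {1})
... | yes _   | no _    | yes _ = refl
... | yes _   | no _    | no _  = refl
... | no _    | yes _   | yes _ = refl
... | no _    | yes _   | no _  = refl
... | no _    | no _    | yes _ = refl
... | no _    | no _    | no _  = refl

exchange : ∀ {n} (C : Config n) (x : ℤ) {R : Fin n → Set} → (∀ u → Dec (R u)) → ℤ
exchange C x R? = Σᵥ (λ u → [ R? u ×-dec (x <? C u) ]) - Σᵥ (λ u → [ R? u ×-dec (C u <? x) ])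

exchange-none : ∀ {n} (C : Config n) x {R : Fin n → Set} (R? : ∀ u → Dec (R u)) →
                (∀ u → ¬ R u) → exchange C x R? ≡ 0ℤ
exchange-none C x R? ¬R = cong₂ _-_ (Σᵥ-[×]-none R? _ ¬R) (Σᵥ-[×]-none R? _ ¬R)

exchange-unique : ∀ {n} (C : Config n) x {R : Fin n → Set} (R? : ∀ u → Dec (R u)) {w} →
                  R w → (∀ {u} → R u → u ≡ w) → exchange C x R? ≡ gain x (C w)
exchange-unique C x R? Rw R-unique =
  cong₂ _-_ (Σᵥ-[×]-unique R? _ Rw R-unique) (Σᵥ-[×]-unique R? _ Rw R-unique)

right-neighbour? : ∀ {n} (v u : Fin n) → Dec (suc (toℕ v) ≡ toℕ u)
right-neighbour? v u = suc (toℕ v) ≟ toℕ u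

left-neighbour? : ∀ {n} (v u : Fin n) → Dec (suc (toℕ u) ≡ toℕ v)
left-neighbour? v u = suc (toℕ u) ≟ toℕ v

exchange-right : ∀ {n} (C : Config n) (v : Fin n) →
                 exchange C (C v) (right-neighbour? v) ≡ flow C (suc (toℕ v))
exchange-right {n} C v with suc (toℕ v) ℕ.<? n
... | yes v+1<n = begin
  exchange C (C v) (right-neighbour? v)
    ≡⟨ exchange-unique C (C v) (right-neighbour? v) (sym tw) (λ eq → toℕ-injective (trans (sym eq) (sym tw))) ⟩
  gain (C v) (C w)      ≡⟨ flow-edge C (sym tw) ⟨
  flow C (toℕ w)        ≡⟨ cong (flow C) tw ⟩
  flow C (suc (toℕ v))  ∎
  where
  open ≡-Reasoning
  w = fromℕ< v+1<n
  tw = toℕ-fromℕ< v+1<n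
... | no v+1≮n =
  trans (exchange-none C (C v) (right-neighbour? v) no-right) (sym (flow-beyond C (ℕP.≮⇒≥ v+1≮n)))
  where
  no-right : ∀ u → suc (toℕ v) ≢ toℕ u
  no-right u eq = v+1≮n (subst (ℕ._< n) (sym eq) (toℕ<n u))

exchange-left : ∀ {n} (C : Config n) (v : Fin n) →
                exchange C (C v) (left-neighbour? v) ≡ - flow C (toℕ v)
exchange-left C zero = exchange-none C (C zero) (left-neighbour? zero) (λ u ())
exchange-left C (suc v) = begin
  exchange C (C (suc v)) (left-neighbour? (suc v))
    ≡⟨ exchange-unique C (C (suc v)) (left-neighbour? (suc v)) w→v+1 w-unique ⟩
  gain (C (suc v)) (C w)          ≡⟨ gain-antisym (C (suc v)) (C w) ⟩
  - gain (C w) (C (suc v))        ≡⟨ cong -_ (flow-edge C w→v+1) ⟨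
  - flow C (toℕ (suc v))          ∎
  where
  open ≡-Reasoning
  w = inject₁ v
  w→v+1 : suc (toℕ w) ≡ suc (toℕ v)
  w→v+1 = cong suc (toℕ-inject₁ v)
  w-unique : ∀ {u} → suc (toℕ u) ≡ suc (toℕ v) → u ≡ w
  w-unique eq = toℕ-injective (trans (ℕP.suc-injective eq) (sym (toℕ-inject₁ v)))

step-path : ∀ {n} (C : Config n) (v : Fin n) →
            step (Path n) C v ≡ C v + flow C (suc (toℕ v)) - flow C (toℕ v)
step-path {n} C v = begin
  step (Path n) C v
    ≡⟨ cong₂ (λ a b → C v + a - b)
         (trans (Σᵥ-cong (λ u → [pathAdj×]-split u v (C v <? C u))) (Σᵥ-distrib-+ lin rin))
         (trans (Σᵥ-cong (λ u → [pathAdj×]-split v u (C u <? C v))) (Σᵥ-distrib-+ rout lout)) ⟩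
  C v + (Σᵥ lin + Σᵥ rin) - (Σᵥ rout + Σᵥ lout)
    ≡⟨ regroup (C v) (Σᵥ lin) (Σᵥ rin) (Σᵥ rout) (Σᵥ lout) ⟩
  C v + exchange C (C v) (right-neighbour? v) + exchange C (C v) (left-neighbour? v)
    ≡⟨ cong₂ (λ a b → C v + a + b) (exchange-right C v) (exchange-left C v) ⟩
  C v + flow C (suc (toℕ v)) - flow C (toℕ v) ∎
  where
  open ≡-Reasoning
  lin rin rout lout : Fin n → ℤ
  lin  u = [ left-neighbour?  v u ×-dec (C v <? C u) ]
  rin  u = [ right-neighbour? v u ×-dec (C v <? C u) ]
  rout u = [ right-neighbour? v u ×-dec (C u <? C v) ]
  lout u = [ left-neighbour?  v u ×-dec (C u <? C v) ]
  regroup : ∀ x a b c d → x + (a + b) - (c + d) ≡ x + (b - c) + (a - d)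
  regroup = solve-∀

pairs-spread : ∀ {n} (P : ℕ → Set) →
  (∀ j → P j → P (suc j) → P (suc (suc j))) →
  (∀ j → suc j ℕ.< n → P (suc j) → P (suc (suc j)) → P j) →
  ∀ {k} → suc k ℕ.< n → P k → P (suc k) → ∀ j → P j
pairs-spread {n} P forward backward {k} k+1<n Pk Pk+1 j =
  [ (λ k≤j → proj₁ (up (ℕP.≤⇒≤′ k≤j))) , (λ j≤k → proj₁ (down (ℕP.≤⇒≤′ j≤k) k+1<n Pk Pk+1)) ]′
  (ℕP.≤-total k j)
  where
  up : ∀ {j} → k ≤′ j → P j × P (suc j)
  up ≤′-refl          = Pk , Pk+1
  up (≤′-step k≤j) with up k≤j
  ... | Pj , Pj+1 = Pj+1 , forward _ Pj Pj+1
  down : ∀ {j m} → j ≤′ m → suc m ℕ.< n → P m → P (suc m) → P j × P (suc j)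
  down ≤′-refl        _     Pm   Pm+1 = Pm , Pm+1
  down (≤′-step j≤m) m+2<n Pm+1 Pm+2 =
    down j≤m (ℕP.<⇒≤ m+2<n) (backward _ (ℕP.<⇒≤ m+2<n) Pm+1 Pm+2) Pm+1

x+a-b+a′-b′≡x⇒a+a′≡b+b′ : ∀ x a b a′ b′ → x + a - b + a′ - b′ ≡ x → a + a′ ≡ b + b′
x+a-b+a′-b′≡x⇒a+a′≡b+b′ x a b a′ b′ eq = begin
  a + a′                                ≡⟨ isolate x a b a′ b′ ⟩
  (x + a - b + a′ - b′) - x + (b + b′)  ≡⟨ cong (λ y → y - x + (b + b′)) eq ⟩
  x - x + (b + b′)                      ≡⟨ cancel x (b + b′) ⟩
  b + b′                                ∎
  where
  open ≡-Reasoning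
  isolate : ∀ x a b a′ b′ → a + a′ ≡ (x + a - b + a′ - b′) - x + (b + b′)
  isolate = solve-∀
  cancel : ∀ x y → x - x + y ≡ y
  cancel = solve-∀

x+0-l≡x+r-0⇒r+l≡0 : ∀ x r l → x + 0ℤ - l ≡ x + r - 0ℤ → r + l ≡ 0ℤ
x+0-l≡x+r-0⇒r+l≡0 x r l eq = begin
  r + l                            ≡⟨ difference x r l ⟩
  (x + r - 0ℤ) - (x + 0ℤ - l)      ≡⟨ cong (λ y → (x + r - 0ℤ) - y) eq ⟩
  (x + r - 0ℤ) - (x + r - 0ℤ)      ≡⟨ ℤP.+-inverseʳ (x + r - 0ℤ) ⟩
  0ℤ                               ∎
  where
  open ≡-Reasoning
  difference : ∀ x r l → r + l ≡ (x + r - 0ℤ) - (x + 0ℤ - l)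
  difference = solve-∀

module Period2 {n} (C : Config n) (period : step (Path n) (step (Path n) C) ≈ C) where

  C′ : Config n
  C′ = step (Path n) C

  flows-cancel : ∀ i → flow C i + flow C′ i ≡ 0ℤ
  flows-cancel zero    = refl
  flows-cancel (suc i) = trans (conserved i) (flows-cancel i)
    where
    conserved : ∀ i → flow C (suc i) + flow C′ (suc i) ≡ flow C i + flow C′ i
    conserved i with i ℕ.<? n
    ... | no i≮n = begin
      flow C (suc i) + flow C′ (suc i)  ≡⟨ cong₂ _+_ (flow-beyond C n≤1+i) (flow-beyond C′ n≤1+i) ⟩
      0ℤ                                ≡⟨ cong₂ _+_ (flow-beyond C n≤i) (flow-beyond C′ n≤i) ⟨
      flow C i + flow C′ i              ∎
      where
      open ≡-Reasoning
      n≤i = ℕP.≮⇒≥ i≮n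
      n≤1+i = ℕP.m≤n⇒m≤1+n n≤i
    ... | yes i<n with fromℕ< i<n | toℕ-fromℕ< i<n
    ...   | v | refl = x+a-b+a′-b′≡x⇒a+a′≡b+b′ (C v) _ _ _ _ (begin
      C v + flow C (suc (toℕ v)) - flow C (toℕ v) + flow C′ (suc (toℕ v)) - flow C′ (toℕ v)
        ≡⟨ cong (λ y → y + flow C′ (suc (toℕ v)) - flow C′ (toℕ v)) (step-path C v) ⟨
      C′ v + flow C′ (suc (toℕ v)) - flow C′ (toℕ v)
        ≡⟨ step-path C′ v ⟨
      step (Path n) C′ v
        ≡⟨ period v ⟩
      C v ∎)
      where open ≡-Reasoning

  flat-edge-reverses : ∀ {u w : Fin n} → suc (toℕ u) ≡ toℕ w → flow C (toℕ w) ≡ 0ℤ →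
                       flow C (suc (toℕ w)) + flow C (toℕ u) ≡ 0ℤ
  flat-edge-reverses {u} {w} u→w flat = x+0-l≡x+r-0⇒r+l≡0 (C u) _ _ (begin
    C u + 0ℤ - flow C (toℕ u)                    ≡⟨ cong (λ y → C u + y - flow C (toℕ u)) flat-right ⟨
    C u + flow C (suc (toℕ u)) - flow C (toℕ u)  ≡⟨ step-path C u ⟨
    C′ u                                         ≡⟨ flat-edge⇒≡ C′ u→w flat′ ⟩
    C′ w                                         ≡⟨ step-path C w ⟩
    C w + flow C (suc (toℕ w)) - flow C (toℕ w)  ≡⟨ cong₂ (λ x y → x + flow C (suc (toℕ w)) - y) Cw≡Cu flat ⟩
    C u + flow C (suc (toℕ w)) - 0ℤ              ∎)
    where
    open ≡-Reasoning
    flat-right : flow C (suc (toℕ u)) ≡ 0ℤ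
    flat-right = trans (cong (flow C) u→w) flat
    Cw≡Cu : C w ≡ C u
    Cw≡Cu = sym (flat-edge⇒≡ C u→w flat)
    flat′ : flow C′ (toℕ w) ≡ 0ℤ
    flat′ = trans (sym (ℤP.+-identityˡ _))
                  (trans (cong (_+ flow C′ (toℕ w)) (sym flat)) (flows-cancel (toℕ w)))

  flat-edge-reverses-at : ∀ j → suc j ℕ.< n → flow C (suc j) ≡ 0ℤ →
                          flow C (suc (suc j)) + flow C j ≡ 0ℤ
  flat-edge-reverses-at j j+1<n with fromℕ< (ℕP.<⇒≤ j+1<n) | toℕ-fromℕ< (ℕP.<⇒≤ j+1<n)
  ... | u | refl = λ flat →
    subst (λ i → flow C (suc i) + flow C (toℕ u) ≡ 0ℤ) tw
          (flat-edge-reverses (sym tw) (subst (λ i → flow C i ≡ 0ℤ) (sym tw) flat))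
    where tw = toℕ-fromℕ< j+1<n

  two-flat-edges⇒all-flat : ∀ {k} → suc k ℕ.< n → flow C k ≡ 0ℤ → flow C (suc k) ≡ 0ℤ →
                            ∀ j → flow C j ≡ 0ℤ
  two-flat-edges⇒all-flat = pairs-spread Flat forward backward
    where
    Flat : ℕ → Set
    Flat i = flow C i ≡ 0ℤ
    forward : ∀ j → Flat j → Flat (suc j) → Flat (suc (suc j))
    forward j Fj Fj+1 with suc j ℕ.<? n
    ... | yes j+1<n =
      trans (sym (ℤP.+-identityʳ _))
            (trans (cong (flow C (suc (suc j)) +_) (sym Fj)) (flat-edge-reverses-at j j+1<n Fj+1))
    ... | no j+1≮n = flow-beyond C (ℕP.m≤n⇒m≤1+n (ℕP.≮⇒≥ j+1≮n))
    backward : ∀ j → suc j ℕ.< n → Flat (suc j) → Flat (suc (suc j)) → Flat j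
    backward j j+1<n Fj+1 Fj+2 =
      trans (sym (ℤP.+-identityˡ _))
            (trans (cong (_+ flow C j) (sym Fj+2)) (flat-edge-reverses-at j j+1<n Fj+1))

  all-flat⇒fixed : (∀ j → flow C j ≡ 0ℤ) → C′ ≈ C
  all-flat⇒fixed all-flat v = begin
    C′ v                                         ≡⟨ step-path C v ⟩
    C v + flow C (suc (toℕ v)) - flow C (toℕ v)  ≡⟨ cong₂ (λ x y → C v + x - y) (all-flat (suc (toℕ v))) (all-flat (toℕ v)) ⟩
    C v + 0ℤ - 0ℤ                                ≡⟨ trans (ℤP.+-identityʳ _) (ℤP.+-identityʳ _) ⟩
    C v                                          ∎
    where open ≡-Reasoning

lemma2p1 : (n : ℕ) (D : Config n) → IsP2Config (Path n) D →
    ¬ HasTwoAdjacentFlatEdges D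
lemma2p1 n D (C₀ , N , periodic , t , N≤t , D≈Cₜ) (a , b , c , a→b , b→c , Da≡Db , Db≡Dc) =
  proj₂ (periodic t N≤t) (all-flat⇒fixed (two-flat-edges⇒all-flat b+1<n flat-ab flat-bc))
  where
  Cₜ = run (Path n) C₀ t
  open Period2 Cₜ (proj₁ (periodic t N≤t))
  b+1<n : suc (toℕ b) ℕ.< n
  b+1<n = subst (ℕ._< n) (sym b→c) (toℕ<n c)
  flat-ab : flow Cₜ (toℕ b) ≡ 0ℤ
  flat-ab = ≡⇒flat-edge Cₜ a→b (trans (sym (D≈Cₜ a)) (trans Da≡Db (D≈Cₜ b)))
  flat-bc : flow Cₜ (suc (toℕ b)) ≡ 0ℤ
  flat-bc = subst (λ i → flow Cₜ i ≡ 0ℤ) (sym b→c)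
                  (≡⇒flat-edge Cₜ b→c (trans (sym (D≈Cₜ b)) (trans Db≡Dc (D≈Cₜ c))))
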